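{- Let $G$ be a finite graph containing at least one cycle, let $H$ be the reduced form of $G$, and suppose $G$ has a difference-1 colouring $c$. Then every vertex $v$ of degree $2$ in $\mathrm{Sk}(G)$ is of one of the following types: leaf-type (degree $3$ in $H$ and adjacent in $H$ to a leaf), twig-type (degree $3$ in $H$ and adjacent in $H$ to the base of a twig), or triple-type (degree $5$ in $H$ and adjacent in $H$ to three leaves). Moreover, if the two edges of $\mathrm{Sk}(G)$ at $v$ receive one blue and one red colour under $c$, then $v$ is leaf-type; if both are blue, then $v$ is twig-type; if both are red, then $v$ is triple-type.
   Context: A colouring of a graph is a map from its edges to $\{\text{blue},\text{red}\}$; it is a difference-1 colouring if at every vertex the number of incident blue edges minus the number of incident red edges equals $1$. A leaf is a vertex of degree $1$. A twig is a vertex $b$ of degree $3$ (its base) with two leaves adjacent to $b$. A leaf-twig configuration at $v$ consists of four vertices distinct from $v$: a leaf $\ell$ and a twig with base $b$, with $\ell$ and $b$ both adjacent to $v$; removing it deletes these four vertices and their four incident edges. The reduced form of $G$ is obtained by repeatedly removing leaf-twig configurations until none remain. The skeleton $\mathrm{Sk}(G)$ is the subgraph obtained by repeatedly deleting leaves (and incident edges) until none remain. -}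

module Defs where

open import Data.Nat using (ℕ; zero; suc; _+_)
open import Data.Bool using (Bool; true; false; _∧_; if_then_else_)
open import Data.Fin using (Fin; zero; suc; inject₁; fromℕ)
open import Data.Fin.Subset using (Subset; _∈_; _-_; ⊤)
open import Data.Vec using (Vec; lookup)
open import Data.Product using (Σ; ∃; _×_; _,_)
open import Relation.Binary.PropositionalEquality using (_≡_; _≢_)
open import Relation.Binary.Construct.Closure.ReflexiveTransitive using (Star)
open import Relation.Nullary using (¬_)
open import Function.Definitions using (Injective)

record Graph (n : ℕ) : Set where
  field
    adj    : Fin n → Fin n → Bool
    sym    : ∀ u v → adj u v ≡ adj v u
    irrefl : ∀ v → adj v v ≡ false
open Graph public

Adj : ∀ {n} → Graph n → Fin n → Fin n → Set
Adj G u v = adj G u v ≡ true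

count : ∀ {n} → (Fin n → Bool) → ℕ
count {zero}  f = 0
count {suc n} f = (if f zero then 1 else 0) + count (λ w → f (suc w))

-- Subgraphs obtained by deleting vertices (together with all incident
-- edges) are the induced subgraphs G[S] for a vertex set S : Subset n.

deg : ∀ {n} → Graph n → Subset n → Fin n → ℕ
deg G S v = count (λ w → lookup S w ∧ adj G v w)

IsLeaf : ∀ {n} → Graph n → Subset n → Fin n → Set
IsLeaf G S v = v ∈ S × deg G S v ≡ 1

IsTwig : ∀ {n} → Graph n → Subset n → Fin n → Fin n → Fin n → Set
IsTwig G S b t₁ t₂ =
  b ∈ S × deg G S b ≡ 3 × t₁ ≢ t₂ ×
  IsLeaf G S t₁ × IsLeaf G S t₂ × Adj G b t₁ × Adj G b t₂

IsTwigBase : ∀ {n} → Graph n → Subset n → Fin n → Set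
IsTwigBase G S b = Σ (Fin _) λ t₁ → Σ (Fin _) λ t₂ → IsTwig G S b t₁ t₂

record LeafTwig {n} (G : Graph n) (S : Subset n) (v ℓ b t₁ t₂ : Fin n) : Set where
  field
    v∈S    : v ∈ S
    leafℓ  : IsLeaf G S ℓ
    twig   : IsTwig G S b t₁ t₂
    adjvℓ  : Adj G v ℓ
    adjvb  : Adj G v b
    v≢ℓ    : v ≢ ℓ
    v≢b    : v ≢ b
    v≢t₁   : v ≢ t₁
    v≢t₂   : v ≢ t₂
    ℓ≢b    : ℓ ≢ b
    ℓ≢t₁   : ℓ ≢ t₁
    ℓ≢t₂   : ℓ ≢ t₂
    b≢t₁   : b ≢ t₁
    b≢t₂   : b ≢ t₂

HasLeafTwig : ∀ {n} → Graph n → Subset n → Set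
HasLeafTwig {n} G S = Σ (Fin n) λ v → Σ (Fin n) λ ℓ → Σ (Fin n) λ b →
  Σ (Fin n) λ t₁ → Σ (Fin n) λ t₂ → LeafTwig G S v ℓ b t₁ t₂

data LTStep {n} (G : Graph n) (S : Subset n) : Subset n → Set where
  remove : ∀ {v ℓ b t₁ t₂} → LeafTwig G S v ℓ b t₁ t₂ →
           LTStep G S (S - ℓ - b - t₁ - t₂)

IsReducedForm : ∀ {n} → Graph n → Subset n → Set
IsReducedForm G H = Star (LTStep G) ⊤ H × ¬ HasLeafTwig G H

data LeafStep {n} (G : Graph n) (S : Subset n) : Subset n → Set where
  remove : ∀ {v} → IsLeaf G S v → LeafStep G S (S - v)

IsSkeleton : ∀ {n} → Graph n → Subset n → Set
IsSkeleton G K = Star (LeafStep G) ⊤ K × (∀ v → ¬ IsLeaf G K v)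

HasCycle : ∀ {n} → Graph n → Set
HasCycle G = Σ ℕ λ k → Σ (Vec (Fin _) (suc (suc (suc k)))) λ cyc →
  Injective _≡_ _≡_ (lookup cyc) ×
  (∀ (i : Fin (suc (suc k))) → Adj G (lookup cyc (inject₁ i)) (lookup cyc (suc i))) ×
  Adj G (lookup cyc (fromℕ (suc (suc k)))) (lookup cyc zero)

data Colour : Set where
  blue red : Colour

isBlue isRed : Colour → Bool
isBlue blue = true
isBlue red  = false
isRed  blue = false
isRed  red  = true

-- a colouring of the edges: a symmetric function (values on non-edges
-- are irrelevant)
record Colouring {n} (G : Graph n) : Set where
  field
    col    : Fin n → Fin n → Colour
    colSym : ∀ u v → col u v ≡ col v u
open Colouring public

IsDiff1 : ∀ {n} (G : Graph n) → Colouring G → Set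
IsDiff1 G c = ∀ v →
  count (λ w → adj G v w ∧ isBlue (col c v w))
    ≡ 1 + count (λ w → adj G v w ∧ isRed (col c v w))

LeafType : ∀ {n} → Graph n → Subset n → Fin n → Set
LeafType G H v = v ∈ H × deg G H v ≡ 3 × Σ (Fin _) λ w → Adj G v w × IsLeaf G H w

TwigType : ∀ {n} → Graph n → Subset n → Fin n → Set
TwigType G H v = v ∈ H × deg G H v ≡ 3 × Σ (Fin _) λ b → Adj G v b × IsTwigBase G H b

TripleType : ∀ {n} → Graph n → Subset n → Fin n → Set
TripleType G H v = v ∈ H × deg G H v ≡ 5 ×
  Σ (Fin _) λ w₁ → Σ (Fin _) λ w₂ → Σ (Fin _) λ w₃ →
    w₁ ≢ w₂ × w₁ ≢ w₃ × w₂ ≢ w₃ ×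
    Adj G v w₁ × Adj G v w₂ × Adj G v w₃ ×
    IsLeaf G H w₁ × IsLeaf G H w₂ × IsLeaf G H w₃

-- A leaf has a single edge, which a difference-1 colouring makes blue; a twig base has degree 3,
-- so two blue leaf edges and one red edge. Hence removing a leaf-twig configuration at v deletes
-- one blue and one red edge at v, and the reduced form H still carries a difference-1 colouring;
-- moreover the removal never touches a vertex of positive degree in the skeleton K. Replaying the
-- leaf deletions that produce K shows that whenever a vertex y of H is deleted while a neighbour p
-- in H is still present, y hangs from p either as a leaf of H joined to p by a blue edge or as a
-- twig base of H joined by a red edge; and since H has no leaf-twig configuration, the vertices
-- hanging from one vertex are all leaves or all twig bases. At a vertex of degree 2 in K the
-- difference-1 equation in H then determines the hanging vertices from the colours of its two
-- skeleton edges.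

module Submission where

open import Defs hiding (sym)
open import Data.Nat using (ℕ; zero; suc; _+_; _≤_; z≤n; s≤s)
open import Data.Nat.Properties using (suc-injective; +-suc; m+n≡0⇒n≡0; m≤n⇒m≤1+n; ≤-trans; ≤∧≢⇒<)
open import Data.Bool using (Bool; true; false; _∧_; not)
open import Data.Bool.Properties using (∧-assoc; ∧-zeroʳ; ¬-not)
open import Data.Fin using (Fin; zero; suc)
open import Data.Fin.Properties using (_≟_)
open import Data.Fin.Subset using (Subset; _∈_; _∉_; _-_; ⊤)
open import Data.Fin.Subset.Properties using (x∈p∧x≢y⇒x∈p-y; p─q⊆p; p─⊥≡p; _∈?_; ∈⊤)
open import Data.Vec using (lookup; _∷_; here; there)
open import Data.Vec.Properties using (lookup⇒[]=; []=⇒lookup; lookup-replicate)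
open import Data.Product using (Σ; ∃; _×_; _,_; proj₁; proj₂)
open import Data.Sum using (_⊎_; inj₁; inj₂; swap)
open import Data.Empty using (⊥; ⊥-elim)
open import Relation.Nullary using (¬_; yes; no)
open import Function using (_∘_)
open import Relation.Binary.Construct.Closure.ReflexiveTransitive using (Star; ε; _◅_)
open import Relation.Binary.PropositionalEquality
  using (_≡_; _≢_; refl; sym; trans; cong; cong₂; subst; subst₂; ≢-sym)

private variable
  n k : ℕ
  S T : Subset n
  f g : Fin n → Bool
  x y : Fin n
  κ κ′ : Colour

x∉p-x : ∀ (S : Subset n) x → x ∉ S - x
x∉p-x (s ∷ S) (suc x) (there x∈S-x) = x∉p-x S x x∈S-x

x∈p-y⇒x≢y : x ∈ S - y → x ≢ y
x∈p-y⇒x≢y {S = S} {y = y} x∈ refl = x∉p-x S y x∈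

x∈p-y⇒x∈p : x ∈ S - y → x ∈ S
x∈p-y⇒x∈p {S = S} = p─q⊆p S _

unmixed-excess : ∀ {b r} k → b ≡ 0 ⊎ r ≡ 0 → b ≡ k + r → r ≡ 0
unmixed-excess k (inj₁ refl) eq = m+n≡0⇒n≡0 k (sym eq)
unmixed-excess k (inj₂ r≡0)  _  = r≡0

count-cong : (∀ w → f w ≡ g w) → count f ≡ count g
count-cong {zero}  eq = refl
count-cong {suc n} {f} {g} eq rewrite eq zero = cong (_ +_) (count-cong (λ w → eq (suc w)))

count-witness : count f ≡ suc k → ∃ λ a → f a ≡ true
count-witness {suc n} {f} eq with f zero in fz
... | true  = zero , fz
... | false with count-witness {f = λ w → f (suc w)} eq
...   | a , fa = suc a , fa

count-mono : (∀ w → f w ≡ true → g w ≡ true) → count f ≤ count g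
count-mono {zero} imp = z≤n
count-mono {suc n} {f} {g} imp
  with f zero in fz | g zero in gz
     | count-mono {f = λ w → f (suc w)} {g = λ w → g (suc w)} (λ w → imp (suc w))
... | true  | true  | le = s≤s le
... | true  | false | _  with trans (sym (imp zero fz)) gz
...   | ()
count-mono imp | false | true  | le = m≤n⇒m≤1+n le
count-mono imp | false | false | le = le

count-split : ∀ (f g : Fin n → Bool) →
  count f ≡ count (λ w → f w ∧ g w) + count (λ w → f w ∧ not (g w))
count-split {zero}  f g = refl
count-split {suc n} f g with f zero | g zero | count-split (λ w → f (suc w)) (λ w → g (suc w))
... | true  | true  | eq = cong suc eq
... | true  | false | eq = trans (cong suc eq) (sym (+-suc _ _))
... | false | true  | eq = eq
... | false | false | eq = eq

-- Opaque so that unification treats countIn S f as rigid and infers S and f from it.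
opaque
  countIn : Subset n → (Fin n → Bool) → ℕ
  countIn S f = count (λ w → lookup S w ∧ f w)

  countIn-⊤ : countIn ⊤ f ≡ count f
  countIn-⊤ {f = f} = count-cong (λ w → cong (_∧ f w) (lookup-replicate w true))

  countIn-cong : (∀ w → w ∈ S → f w ≡ g w) → countIn S f ≡ countIn S g
  countIn-cong {S = S} {f = f} {g = g} eq = count-cong pointwise
    where
    pointwise : ∀ w → lookup S w ∧ f w ≡ lookup S w ∧ g w
    pointwise w with lookup S w in e
    ... | true  = eq w (lookup⇒[]= w S e)
    ... | false = refl

  countIn-split : ∀ (S : Subset n) (f g : Fin n → Bool) →
    countIn S f ≡ countIn S (λ w → f w ∧ g w) + countIn S (λ w → f w ∧ not (g w))
  countIn-split S f g = trans (count-split (λ w → lookup S w ∧ f w) g)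
    (cong₂ _+_ (count-cong λ w → ∧-assoc (lookup S w) (f w) (g w))
               (count-cong λ w → ∧-assoc (lookup S w) (f w) (not (g w))))

  countIn-mono : (∀ w → w ∈ S → f w ≡ true → w ∈ T) → countIn S f ≤ countIn T f
  countIn-mono {S = S} {f = f} {T = T} imp = count-mono pointwise
    where
    pointwise : ∀ w → lookup S w ∧ f w ≡ true → lookup T w ∧ f w ≡ true
    pointwise w h with lookup S w in e | f w in fw
    ... | true | true = cong (_∧ true) ([]=⇒lookup (imp w (lookup⇒[]= w S e) fw))

  countIn-remove : x ∈ S → f x ≡ true → countIn S f ≡ suc (countIn (S - x) f)
  countIn-remove {x = zero} {S = true ∷ S} {f} here fx rewrite fx =
    cong (λ T → suc (countIn T (λ w → f (suc w)))) (sym (p─⊥≡p S))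
  countIn-remove {x = suc x} {S = s ∷ S} {f} (there x∈S) fx =
    trans (cong (_ +_) (countIn-remove {f = λ w → f (suc w)} x∈S fx)) (+-suc _ _)

  countIn-remove-false : f x ≡ false → countIn (S - x) f ≡ countIn S f
  countIn-remove-false {f = f} {x = zero} {S = s ∷ S} fx rewrite fx with s
  ... | true  = cong (λ T → countIn T (λ w → f (suc w))) (p─⊥≡p S)
  ... | false = cong (λ T → countIn T (λ w → f (suc w))) (p─⊥≡p S)
  countIn-remove-false {f = f} {x = suc x} {S = s ∷ S} fx =
    cong (_ +_) (countIn-remove-false {f = λ w → f (suc w)} {S = S} fx)

  countIn-nonempty : countIn S f ≡ suc k → ∃ λ a → a ∈ S × f a ≡ true
  countIn-nonempty {S = S} {f = f} eq with count-witness eq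
  ... | a , Sfa with lookup S a in Sa | f a in fa
  ...   | true | true = a , lookup⇒[]= a S Sa , fa

  deg≡countIn : ∀ (G : Graph n) S v → deg G S v ≡ countIn S (adj G v)
  deg≡countIn G S v = refl

countIn-remove-suc : x ∈ S → f x ≡ true → countIn S f ≡ suc k → countIn (S - x) f ≡ k
countIn-remove-suc x∈S fx eq = suc-injective (trans (sym (countIn-remove x∈S fx)) eq)

countIn≡0 : countIn S f ≡ 0 → x ∈ S → f x ≢ true
countIn≡0 eq x∈S fx with trans (sym (countIn-remove x∈S fx)) eq
... | ()

countIn≡1 : countIn S f ≡ 1 → x ∈ S → f x ≡ true → y ∈ S → f y ≡ true → y ≡ x
countIn≡1 {x = x} {y = y} eq x∈S fx y∈S fy with y ≟ x
... | yes y≡x = y≡x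
... | no  y≢x = ⊥-elim (countIn≡0 (countIn-remove-suc x∈S fx eq) (x∈p∧x≢y⇒x∈p-y y∈S y≢x) fy)

countIn-witness : countIn S f ≡ suc k →
  ∃ λ a → a ∈ S × f a ≡ true × countIn (S - a) f ≡ k
countIn-witness eq with countIn-nonempty eq
... | a , a∈S , fa = a , a∈S , fa , countIn-remove-suc a∈S fa eq

countIn-witness₂ : countIn S f ≡ 2 → Σ (Fin n) λ a → Σ (Fin n) λ b →
  a ≢ b × a ∈ S × b ∈ S × f a ≡ true × f b ≡ true
countIn-witness₂ eq with countIn-witness eq
... | a , a∈S , fa , rest with countIn-witness rest
...   | b , b∈S-a , fb , _ = a , b , ≢-sym (x∈p-y⇒x≢y b∈S-a) , a∈S , x∈p-y⇒x∈p b∈S-a , fa , fb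

countIn-witness₃ : countIn S f ≡ 3 → Σ (Fin n) λ a → Σ (Fin n) λ b → Σ (Fin n) λ c →
  a ≢ b × a ≢ c × b ≢ c × a ∈ S × b ∈ S × c ∈ S × f a ≡ true × f b ≡ true × f c ≡ true
countIn-witness₃ eq with countIn-witness eq
... | a , a∈S , fa , rest with countIn-witness₂ rest
...   | b , c , b≢c , b∈S-a , c∈S-a , fb , fc =
  a , b , c , ≢-sym (x∈p-y⇒x≢y b∈S-a) , ≢-sym (x∈p-y⇒x≢y c∈S-a) , b≢c ,
  a∈S , x∈p-y⇒x∈p b∈S-a , x∈p-y⇒x∈p c∈S-a , fa , fb , fc

-- Leaves, twigs and the skeleton

module _ (G : Graph n) where

  Adj-sym : Adj G x y → Adj G y x
  Adj-sym {x = x} {y = y} = trans (Graph.sym G y x)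

  Adj⇒≢ : Adj G x y → x ≢ y
  Adj⇒≢ {x = x} x~x refl with trans (sym x~x) (irrefl G x)
  ... | ()

  leaf-nbr-unique : ∀ {t} → IsLeaf G S t → x ∈ S → Adj G t x → y ∈ S → Adj G t y → y ≡ x
  leaf-nbr-unique {S = S} {t = t} (_ , deg≡1) = countIn≡1 (trans (sym (deg≡countIn G S t)) deg≡1)

  twig-base-third-nbr : ∀ {b t₁ t₂} → IsTwig G S b t₁ t₂ → countIn (S - t₁ - t₂) (adj G b) ≡ 1
  twig-base-third-nbr {S = S} {b = b} (_ , deg≡3 , t₁≢t₂ , (t₁∈S , _) , (t₂∈S , _) , b~t₁ , b~t₂) =
    countIn-remove-suc (x∈p∧x≢y⇒x∈p-y t₂∈S (≢-sym t₁≢t₂)) b~t₂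
      (countIn-remove-suc t₁∈S b~t₁ (trans (sym (deg≡countIn G S b)) deg≡3))

  leaf-twig-configuration : ∀ {v ℓ b t₁ t₂} → v ∈ S → Adj G v ℓ → IsLeaf G S ℓ →
    Adj G v b → IsTwig G S b t₁ t₂ → LeafTwig G S v ℓ b t₁ t₂
  leaf-twig-configuration {v = v} v∈S v~ℓ leafℓ@(ℓ∈S , degℓ≡1) v~b
    twig@(b∈S , degb≡3 , _ , leaf₁ , leaf₂ , b~t₁ , b~t₂) = record
    { v∈S = v∈S ; leafℓ = leafℓ ; twig = twig ; adjvℓ = v~ℓ ; adjvb = v~b
    ; v≢ℓ = Adj⇒≢ v~ℓ ; v≢b = Adj⇒≢ v~b
    ; v≢t₁ = λ { refl → ℓ≢b (leaf-nbr-unique leaf₁ b∈S (Adj-sym b~t₁) ℓ∈S v~ℓ) }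
    ; v≢t₂ = λ { refl → ℓ≢b (leaf-nbr-unique leaf₂ b∈S (Adj-sym b~t₂) ℓ∈S v~ℓ) }
    ; ℓ≢b = ℓ≢b
    ; ℓ≢t₁ = λ { refl → Adj⇒≢ v~b (leaf-nbr-unique leaf₁ b∈S (Adj-sym b~t₁) v∈S (Adj-sym v~ℓ)) }
    ; ℓ≢t₂ = λ { refl → Adj⇒≢ v~b (leaf-nbr-unique leaf₂ b∈S (Adj-sym b~t₂) v∈S (Adj-sym v~ℓ)) }
    ; b≢t₁ = Adj⇒≢ b~t₁ ; b≢t₂ = Adj⇒≢ b~t₂ }
    where
    ℓ≢b : _ ≢ _
    ℓ≢b refl with trans (sym degℓ≡1) degb≡3
    ... | ()

  Leafless : Subset n → Set
  Leafless K = ∀ v → ¬ IsLeaf G K v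

  -- Isolated vertices of the skeleton need not survive the reduction, hence the degree bound.
  Retains : Subset n → Subset n → Set
  Retains K S = ∀ z → z ∈ K → 2 ≤ deg G K z → z ∈ S

  module _ {K : Subset n} (leafless : Leafless K) where

    leafless-nbr-deg : x ∈ K → y ∈ K → Adj G x y → 2 ≤ deg G K y
    leafless-nbr-deg {y = y} x∈K y∈K x~y =
      ≤∧≢⇒< (subst (1 ≤_) (sym (trans (deg≡countIn G K y) (countIn-remove x∈K (Adj-sym x~y))))
                   (s≤s z≤n))
            (λ 1≡deg → leafless y (y∈K , sym 1≡deg))

    retained-nbr : Retains K S → x ∈ K → y ∈ K → Adj G x y → y ∈ S
    retained-nbr retains x∈K y∈K x~y = retains _ y∈K (leafless-nbr-deg x∈K y∈K x~y)

    deg-retained : Retains K S → x ∈ K → deg G K x ≤ deg G S x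
    deg-retained {S = S} {x = x} retains x∈K =
      subst₂ _≤_ (sym (deg≡countIn G K x)) (sym (deg≡countIn G S x))
        (countIn-mono (λ y y∈K x~y → retained-nbr retains x∈K y∈K x~y))

    retained-not-leaf : Retains K S → x ∈ K → 2 ≤ deg G K x → ¬ IsLeaf G S x
    retained-not-leaf {S = S} {x = x} retains x∈K 2≤deg (_ , deg≡1)
      with ≤-trans 2≤deg (subst (deg G K x ≤_) deg≡1 (deg-retained retains x∈K))
    ... | s≤s ()

  module LeafTwigRemoval {S : Subset n} {v ℓ b t₁ t₂ : Fin n} (L : LeafTwig G S v ℓ b t₁ t₂) where
    open LeafTwig L

    S′ : Subset n
    S′ = S - ℓ - b - t₁ - t₂

    b∈S : b ∈ S
    b∈S = proj₁ twig
    leaf₁ : IsLeaf G S t₁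
    leaf₁ = proj₁ (proj₂ (proj₂ (proj₂ twig)))
    leaf₂ : IsLeaf G S t₂
    leaf₂ = proj₁ (proj₂ (proj₂ (proj₂ (proj₂ twig))))
    b~t₁ : Adj G b t₁
    b~t₁ = proj₁ (proj₂ (proj₂ (proj₂ (proj₂ (proj₂ twig)))))
    b~t₂ : Adj G b t₂
    b~t₂ = proj₂ (proj₂ (proj₂ (proj₂ (proj₂ (proj₂ twig)))))

    ∈-S′ : x ∈ S′ → x ∈ S × x ≢ ℓ × x ≢ b × x ≢ t₁ × x ≢ t₂
    ∈-S′ x∈S′ =
      x∈p-y⇒x∈p (x∈p-y⇒x∈p (x∈p-y⇒x∈p (x∈p-y⇒x∈p x∈S′))) ,
      x∈p-y⇒x≢y (x∈p-y⇒x∈p (x∈p-y⇒x∈p (x∈p-y⇒x∈p x∈S′))) ,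
      x∈p-y⇒x≢y (x∈p-y⇒x∈p (x∈p-y⇒x∈p x∈S′)) ,
      x∈p-y⇒x≢y (x∈p-y⇒x∈p x∈S′) ,
      x∈p-y⇒x≢y x∈S′

    v∈S-t₁-t₂ : v ∈ S - t₁ - t₂
    v∈S-t₁-t₂ = x∈p∧x≢y⇒x∈p-y (x∈p∧x≢y⇒x∈p-y v∈S v≢t₁) v≢t₂

    only-v~ℓ : x ∈ S → Adj G x ℓ → x ≡ v
    only-v~ℓ x∈S x~ℓ = leaf-nbr-unique leafℓ v∈S (Adj-sym adjvℓ) x∈S (Adj-sym x~ℓ)

    only-b~t : ∀ {t} → IsLeaf G S t → Adj G b t → x ∈ S → Adj G x t → x ≡ b
    only-b~t leaf b~t x∈S x~t = leaf-nbr-unique leaf b∈S (Adj-sym b~t) x∈S (Adj-sym x~t)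

    only-v~b : x ∈ S - t₁ - t₂ → Adj G x b → x ≡ v
    only-v~b x∈ x~b = countIn≡1 (twig-base-third-nbr twig) v∈S-t₁-t₂ (Adj-sym adjvb) x∈ (Adj-sym x~b)

    removal-away-from-v : ∀ (h : Fin n → Bool) → x ∈ S′ → x ≢ v →
      countIn S′ (λ w → adj G x w ∧ h w) ≡ countIn S (λ w → adj G x w ∧ h w)
    removal-away-from-v {x = x} h x∈S′ x≢v with ∈-S′ x∈S′
    ... | x∈S , _ , x≢b , x≢t₁ , x≢t₂ =
      trans (countIn-remove-false (unrelated (x≢b ∘ only-b~t leaf₂ b~t₂ x∈S)))
      (trans (countIn-remove-false (unrelated (x≢b ∘ only-b~t leaf₁ b~t₁ x∈S)))
      (trans (countIn-remove-false (unrelated (x≢v ∘ only-v~b x∈S-t₁-t₂)))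
             (countIn-remove-false (unrelated (x≢v ∘ only-v~ℓ x∈S)))))
      where
      x∈S-t₁-t₂ : x ∈ S - t₁ - t₂
      x∈S-t₁-t₂ = x∈p∧x≢y⇒x∈p-y (x∈p∧x≢y⇒x∈p-y x∈S x≢t₁) x≢t₂
      unrelated : ∀ {y} → ¬ Adj G x y → adj G x y ∧ h y ≡ false
      unrelated {y} x≁y = cong (_∧ h y) (¬-not x≁y)

    retains-after : ∀ {K} → Leafless K → Retains K S → Retains K S′
    retains-after {K} leafless retains z z∈K 2≤deg =
      x∈p∧x≢y⇒x∈p-y (x∈p∧x≢y⇒x∈p-y (x∈p∧x≢y⇒x∈p-y (x∈p∧x≢y⇒x∈p-y z∈S
        (not-leaf leafℓ)) z≢b) (not-leaf leaf₁)) (not-leaf leaf₂)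
      where
      z∈S : z ∈ S
      z∈S = retains z z∈K 2≤deg

      not-leaf : ∀ {t} → IsLeaf G S t → z ≢ t
      not-leaf leaf refl = retained-not-leaf leafless retains z∈K 2≤deg leaf

      twig-leaf-not-in-K : ∀ {t} → IsLeaf G S t → b ∈ K → t ∈ K → Adj G b t → ⊥
      twig-leaf-not-in-K leaf b∈K t∈K b~t =
        retained-not-leaf leafless retains t∈K (leafless-nbr-deg leafless b∈K t∈K b~t) leaf

      z≢b : z ≢ b
      z≢b refl with ≤-trans 2≤deg (subst₂ _≤_ (sym (deg≡countIn G K b)) (twig-base-third-nbr twig)
        (countIn-mono λ y y∈K b~y → x∈p∧x≢y⇒x∈p-y (x∈p∧x≢y⇒x∈p-y
          (retained-nbr leafless retains z∈K y∈K b~y)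
          λ { refl → twig-leaf-not-in-K leaf₁ z∈K y∈K b~y })
          λ { refl → twig-leaf-not-in-K leaf₂ z∈K y∈K b~y }))
      ... | s≤s ()

-- Difference-1 colourings

module _ (G : Graph n) (c : Colouring G) where

  blueEdge redEdge : Fin n → Fin n → Bool
  blueEdge v w = adj G v w ∧ isBlue (col c v w)
  redEdge  v w = adj G v w ∧ isRed (col c v w)

  blueEdge-true : Adj G x y → col c x y ≡ blue → blueEdge x y ≡ true
  blueEdge-true x~y col≡ rewrite x~y | col≡ = refl

  redEdge-true : Adj G x y → col c x y ≡ red → redEdge x y ≡ true
  redEdge-true x~y col≡ rewrite x~y | col≡ = refl

  blueEdge-false : col c x y ≡ red → blueEdge x y ≡ false
  blueEdge-false {x = x} {y = y} col≡ rewrite col≡ = ∧-zeroʳ (adj G x y)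

  redEdge-false : col c x y ≡ blue → redEdge x y ≡ false
  redEdge-false {x = x} {y = y} col≡ rewrite col≡ = ∧-zeroʳ (adj G x y)

  blueEdge⇒ : blueEdge x y ≡ true → Adj G x y × col c x y ≡ blue
  blueEdge⇒ {x = x} {y = y} e with adj G x y | col c x y
  ... | true | blue = refl , refl

  redEdge⇒ : redEdge x y ≡ true → Adj G x y × col c x y ≡ red
  redEdge⇒ {x = x} {y = y} e with adj G x y | col c x y
  ... | true | red = refl , refl

  deg-split : ∀ S v → deg G S v ≡ countIn S (blueEdge v) + countIn S (redEdge v)
  deg-split S v =
    trans (deg≡countIn G S v) (trans (countIn-split S (adj G v) (λ w → isBlue (col c v w)))
      (cong (countIn S (blueEdge v) +_)
            (countIn-cong {S = S} λ w _ → cong (adj G v w ∧_) (not-isBlue (col c v w)))))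
    where
    not-isBlue : ∀ k → not (isBlue k) ≡ isRed k
    not-isBlue blue = refl
    not-isBlue red  = refl

  deg-from-counts : ∀ {b r} → countIn S (blueEdge x) ≡ b → countIn S (redEdge x) ≡ r →
    deg G S x ≡ b + r
  deg-from-counts {S = S} {x = x} blues reds = trans (deg-split S x) (cong₂ _+_ blues reds)

  Diff1On : Subset n → Set
  Diff1On S = ∀ v → v ∈ S → countIn S (blueEdge v) ≡ suc (countIn S (redEdge v))

  Diff1On-⊤ : IsDiff1 G c → Diff1On ⊤
  Diff1On-⊤ diff1 v _ =
    trans (countIn-⊤ {f = blueEdge v}) (trans (diff1 v) (cong suc (sym (countIn-⊤ {f = redEdge v}))))

  blueℕ redℕ : Colour → ℕ
  blueℕ blue = 1
  blueℕ red  = 0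
  redℕ  blue = 0
  redℕ  red  = 1

  remove-edge : y ∈ S → Adj G x y → col c x y ≡ κ →
    countIn S (blueEdge x) ≡ blueℕ κ + countIn (S - y) (blueEdge x) ×
    countIn S (redEdge x) ≡ redℕ κ + countIn (S - y) (redEdge x)
  remove-edge {κ = blue} y∈S x~y col≡ =
    countIn-remove y∈S (blueEdge-true x~y col≡) , sym (countIn-remove-false (redEdge-false col≡))
  remove-edge {κ = red}  y∈S x~y col≡ =
    sym (countIn-remove-false (blueEdge-false col≡)) , countIn-remove y∈S (redEdge-true x~y col≡)

  diff1-deg : Diff1On S → x ∈ S → deg G S x ≡ suc (countIn S (redEdge x) + countIn S (redEdge x))
  diff1-deg {S = S} {x = x} diff1 x∈S =
    trans (deg-split S x) (cong (_+ countIn S (redEdge x)) (diff1 x x∈S))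

  leaf-edge-blue : Diff1On S → ∀ {t} → IsLeaf G S t → x ∈ S → Adj G t x → col c t x ≡ blue
  leaf-edge-blue {S = S} {x = x} diff1 {t} (t∈S , deg≡1) x∈S t~x with col c t x in col≡
  ... | blue = refl
  ... | red  = ⊥-elim (countIn≡0 no-red x∈S (redEdge-true t~x col≡))
    where
    no-red : countIn S (redEdge t) ≡ 0
    no-red = m+n≡0⇒n≡0 (countIn S (redEdge t)) (suc-injective (trans (sym (diff1-deg diff1 t∈S)) deg≡1))

  twig-edge-red : Diff1On S → ∀ {b t₁ t₂} → IsTwig G S b t₁ t₂ →
    x ∈ S - t₁ - t₂ → Adj G b x → col c b x ≡ red
  twig-edge-red {S = S} {x = x} diff1 {b} (b∈S , deg≡3 , t₁≢t₂ , leaf₁ , leaf₂ , b~t₁ , b~t₂) x∈ b~x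
    with col c b x in col≡
  ... | red  = refl
  ... | blue = ⊥-elim (countIn≡0 no-blue-left x∈ (blueEdge-true b~x col≡))
    where
    one-red : countIn S (redEdge b) ≡ 1
    one-red = half (suc-injective (trans (sym (diff1-deg diff1 b∈S)) deg≡3))
      where
      half : ∀ {r} → r + r ≡ 2 → r ≡ 1
      half {suc zero}    _  = refl
      half {suc (suc r)} eq with m+n≡0⇒n≡0 r (suc-injective (suc-injective eq))
      ... | ()

    leaf-blue : ∀ {t} → IsLeaf G S t → Adj G b t → blueEdge b t ≡ true
    leaf-blue {t} leaf b~t =
      blueEdge-true b~t (trans (colSym c b t) (leaf-edge-blue diff1 leaf b∈S (Adj-sym G b~t)))

    no-blue-left : countIn (S - _ - _) (blueEdge b) ≡ 0
    no-blue-left =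
      countIn-remove-suc (x∈p∧x≢y⇒x∈p-y (proj₁ leaf₂) (≢-sym t₁≢t₂)) (leaf-blue leaf₂ b~t₂)
        (countIn-remove-suc (proj₁ leaf₁) (leaf-blue leaf₁ b~t₁)
          (trans (diff1 b b∈S) (cong suc one-red)))

  module _ {S : Subset n} {v ℓ b t₁ t₂ : Fin n} (diff1 : Diff1On S) (L : LeafTwig G S v ℓ b t₁ t₂) where
    open LeafTwig L
    open LeafTwigRemoval G L

    private
      col-vℓ : col c v ℓ ≡ blue
      col-vℓ = trans (colSym c v ℓ) (leaf-edge-blue diff1 leafℓ v∈S (Adj-sym G adjvℓ))

      col-vb : col c v b ≡ red
      col-vb = trans (colSym c v b) (twig-edge-red diff1 twig v∈S-t₁-t₂ (Adj-sym G adjvb))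

      twig-leaves-away-from-v : ∀ (h : Fin n → Bool) →
        countIn S′ (λ w → adj G v w ∧ h w) ≡ countIn (S - ℓ - b) (λ w → adj G v w ∧ h w)
      twig-leaves-away-from-v h =
        trans (countIn-remove-false (cong (_∧ h t₂) (¬-not (v≢b ∘ only-b~t leaf₂ b~t₂ v∈S))))
              (countIn-remove-false (cong (_∧ h t₁) (¬-not (v≢b ∘ only-b~t leaf₁ b~t₁ v∈S))))

      blue-at-v : countIn S (blueEdge v) ≡ suc (countIn S′ (blueEdge v))
      blue-at-v = trans (proj₁ (remove-edge (proj₁ leafℓ) adjvℓ col-vℓ))
        (cong suc (sym (trans (twig-leaves-away-from-v _)
                              (countIn-remove-false (blueEdge-false col-vb)))))

      red-at-v : countIn S (redEdge v) ≡ suc (countIn S′ (redEdge v))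
      red-at-v = trans (proj₂ (remove-edge (proj₁ leafℓ) adjvℓ col-vℓ))
        (trans (proj₂ (remove-edge (x∈p∧x≢y⇒x∈p-y b∈S (≢-sym ℓ≢b)) adjvb col-vb))
               (cong suc (sym (twig-leaves-away-from-v _))))

    diff1-after-removal : Diff1On S′
    diff1-after-removal x x∈S′ with x ≟ v
    ... | yes refl = suc-injective (trans (sym blue-at-v) (trans (diff1 v v∈S) (cong suc red-at-v)))
    ... | no  x≢v  = trans (removal-away-from-v _ x∈S′ x≢v)
      (trans (diff1 x (proj₁ (∈-S′ x∈S′))) (cong suc (sym (removal-away-from-v _ x∈S′ x≢v))))

  reduction-invariants : ∀ {K S T} → Leafless G K → Star (LTStep G) S T →
    Diff1On S → Retains G K S → Diff1On T × Retains G K T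
  reduction-invariants leafless ε                  diff1 retains = diff1 , retains
  reduction-invariants leafless (remove L ◅ steps) diff1 retains =
    reduction-invariants leafless steps (diff1-after-removal diff1 L)
      (LeafTwigRemoval.retains-after G L leafless retains)

  -- Vertices hanging from the skeleton

  Pendant : Subset n → Fin n → Fin n → Set
  Pendant H p y = (IsLeaf G H y × col c p y ≡ blue) ⊎ (IsTwigBase G H y × col c p y ≡ red)

  PendantsOutside : Subset n → Subset n → Set
  PendantsOutside H S = ∀ y p → y ∉ S → p ∈ S → Adj G p y → y ∈ H → p ∈ H → Pendant H p y

  pendants-outside-⊤ : ∀ {H} → PendantsOutside H ⊤
  pendants-outside-⊤ y _ y∉⊤ = ⊥-elim (y∉⊤ ∈⊤)

  module _ {H : Subset n} (diff1 : Diff1On H) (reduced : ¬ HasLeafTwig G H) where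

    module _ {x : Fin n} {O : Subset n} (x∈H : x ∈ H)
             (pendants : ∀ y → y ∈ O → Adj G x y → Pendant H x y) where

      blue-pendant-leaf : y ∈ O → blueEdge x y ≡ true → IsLeaf G H y × Adj G x y
      blue-pendant-leaf {y} y∈O x-y-blue with blueEdge⇒ x-y-blue
      ... | x~y , col≡ with pendants y y∈O x~y
      ...   | inj₁ (leaf , _)  = leaf , x~y
      ...   | inj₂ (_ , col≡′) with trans (sym col≡) col≡′
      ...     | ()

      red-pendant-twig : y ∈ O → redEdge x y ≡ true → IsTwigBase G H y × Adj G x y
      red-pendant-twig {y} y∈O x-y-red with redEdge⇒ x-y-red
      ... | x~y , col≡ with pendants y y∈O x~y
      ...   | inj₂ (twig , _)  = twig , x~y
      ...   | inj₁ (_ , col≡′) with trans (sym col≡) col≡′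
      ...     | ()

      pendants-unmixed : countIn O (blueEdge x) ≡ 0 ⊎ countIn O (redEdge x) ≡ 0
      pendants-unmixed with countIn O (blueEdge x) in blues | countIn O (redEdge x) in reds
      ... | zero  | _     = inj₁ refl
      ... | suc _ | zero  = inj₂ refl
      ... | suc _ | suc _ with countIn-witness blues | countIn-witness reds
      ...   | ℓ , ℓ∈O , blueℓ , _ | b , b∈O , redb , _
        with blue-pendant-leaf ℓ∈O blueℓ | red-pendant-twig b∈O redb
      ...     | leaf , x~ℓ | (t₁ , t₂ , twig) , x~b =
        ⊥-elim (reduced (x , ℓ , b , t₁ , t₂ , leaf-twig-configuration G x∈H x~ℓ leaf x~b twig))

    pendant-of-pendant-nbrs : ∀ {x p} → x ∈ H → p ∈ H → Adj G x p →
      (∀ y → y ∈ H - p → Adj G x y → Pendant H x y) → Pendant H p x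
    pendant-of-pendant-nbrs {x} {p} x∈H p∈H x~p pendants with col c x p in col≡
    ... | blue = inj₁ ((x∈H , deg≡1) , trans (colSym c p x) col≡)
      where
      B R : ℕ
      B = countIn (H - p) (blueEdge x)
      R = countIn (H - p) (redEdge x)
      counts : countIn H (blueEdge x) ≡ suc B × countIn H (redEdge x) ≡ R
      counts = remove-edge p∈H x~p col≡
      B≡R : B ≡ R
      B≡R = suc-injective (trans (sym (proj₁ counts)) (trans (diff1 x x∈H) (cong suc (proj₂ counts))))
      R≡0 : R ≡ 0
      R≡0 = unmixed-excess 0 (pendants-unmixed x∈H pendants) B≡R
      deg≡1 : deg G H x ≡ 1
      deg≡1 = trans (deg-from-counts (proj₁ counts) (proj₂ counts))
                    (cong₂ (λ b r → suc b + r) (trans B≡R R≡0) R≡0)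
    ... | red = inj₂ (twig-leaves (countIn-witness₂ B≡2) , trans (colSym c p x) col≡)
      where
      B R : ℕ
      B = countIn (H - p) (blueEdge x)
      R = countIn (H - p) (redEdge x)
      counts : countIn H (blueEdge x) ≡ B × countIn H (redEdge x) ≡ suc R
      counts = remove-edge p∈H x~p col≡
      B≡2+R : B ≡ 2 + R
      B≡2+R = trans (sym (proj₁ counts)) (trans (diff1 x x∈H) (cong suc (proj₂ counts)))
      R≡0 : R ≡ 0
      R≡0 = unmixed-excess 2 (pendants-unmixed x∈H pendants) B≡2+R
      B≡2 : B ≡ 2
      B≡2 = trans B≡2+R (cong (2 +_) R≡0)
      deg≡3 : deg G H x ≡ 3
      deg≡3 = trans (deg-from-counts (proj₁ counts) (proj₂ counts))
                    (cong₂ (λ b r → b + suc r) B≡2 R≡0)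
      twig-leaves : (Σ (Fin n) λ t₁ → Σ (Fin n) λ t₂ → t₁ ≢ t₂ × t₁ ∈ H - p × t₂ ∈ H - p ×
        blueEdge x t₁ ≡ true × blueEdge x t₂ ≡ true) → IsTwigBase G H x
      twig-leaves (t₁ , t₂ , t₁≢t₂ , t₁∈ , t₂∈ , blue₁ , blue₂)
        with blue-pendant-leaf x∈H pendants t₁∈ blue₁ | blue-pendant-leaf x∈H pendants t₂∈ blue₂
      ... | leaf₁ , x~t₁ | leaf₂ , x~t₂ = t₁ , t₂ , x∈H , deg≡3 , t₁≢t₂ , leaf₁ , leaf₂ , x~t₁ , x~t₂

    pendants-outside-step : LeafStep G S T → PendantsOutside H S → PendantsOutside H T
    pendants-outside-step {S = S} (remove {x} leaf) outside y p y∉ p∈ p~y y∈H p∈H with y ≟ x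
    ... | no y≢x   = outside y p (y∉ ∘ λ y∈S → x∈p∧x≢y⇒x∈p-y y∈S y≢x) (x∈p-y⇒x∈p p∈) p~y y∈H p∈H
    ... | yes refl = pendant-of-pendant-nbrs y∈H p∈H (Adj-sym G p~y) nbrs-pendant
      where
      nbrs-pendant : ∀ w → w ∈ H - p → Adj G y w → Pendant H y w
      nbrs-pendant w w∈ y~w with w ∈? S
      ... | yes w∈S = ⊥-elim (x∈p-y⇒x≢y w∈
                        (leaf-nbr-unique G leaf (x∈p-y⇒x∈p p∈) (Adj-sym G p~y) w∈S y~w))
      ... | no  w∉S = outside w y w∉S (proj₁ leaf) y~w (x∈p-y⇒x∈p w∈) y∈H

    pendants-outside : Star (LeafStep G) S T → PendantsOutside H S → PendantsOutside H T
    pendants-outside ε              outside = outside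
    pendants-outside (step ◅ steps) outside =
      pendants-outside steps (pendants-outside-step step outside)

    module DegreeTwoVertex {K : Subset n} (leafless : Leafless G K) (retains : Retains G K H)
      (outside : PendantsOutside H K) {v u w : Fin n} (v∈K : v ∈ K) (deg≡2 : deg G K v ≡ 2)
      (u∈K : u ∈ K) (w∈K : w ∈ K) (u≢w : u ≢ w) (v~u : Adj G v u) (v~w : Adj G v w) where

      v∈H : v ∈ H
      v∈H = retains v v∈K (subst (2 ≤_) (sym deg≡2) (s≤s (s≤s z≤n)))

      u∈H : u ∈ H
      u∈H = retained-nbr G leafless retains v∈K u∈K v~u

      w∈H-u : w ∈ H - u
      w∈H-u = x∈p∧x≢y⇒x∈p-y (retained-nbr G leafless retains v∈K w∈K v~w) (≢-sym u≢w)

      O : Subset n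
      O = H - u - w

      others-pendant : ∀ y → y ∈ O → Adj G v y → Pendant H v y
      others-pendant y y∈O v~y with y ∈? K
      ... | no  y∉K = outside y v y∉K v∈K v~y (x∈p-y⇒x∈p (x∈p-y⇒x∈p y∈O)) v∈H
      ... | yes y∈K = ⊥-elim (countIn≡0 no-third-nbr y∈K-u-w v~y)
        where
        no-third-nbr : countIn (K - u - w) (adj G v) ≡ 0
        no-third-nbr = countIn-remove-suc (x∈p∧x≢y⇒x∈p-y w∈K (≢-sym u≢w)) v~w
          (countIn-remove-suc u∈K v~u (trans (sym (deg≡countIn G K v)) deg≡2))
        y∈K-u-w : y ∈ K - u - w
        y∈K-u-w = x∈p∧x≢y⇒x∈p-y (x∈p∧x≢y⇒x∈p-y y∈K (x∈p-y⇒x≢y (x∈p-y⇒x∈p y∈O))) (x∈p-y⇒x≢y y∈O)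

      B R : ℕ
      B = countIn O (blueEdge v)
      R = countIn O (redEdge v)

      unmixed : B ≡ 0 ⊎ R ≡ 0
      unmixed = pendants-unmixed v∈H others-pendant

      leaf-nbr : B ≡ suc k → Σ (Fin n) λ ℓ → Adj G v ℓ × IsLeaf G H ℓ
      leaf-nbr B≡1+k with countIn-witness B≡1+k
      ... | ℓ , ℓ∈O , blueℓ , _ with blue-pendant-leaf v∈H others-pendant ℓ∈O blueℓ
      ...   | leaf , v~ℓ = ℓ , v~ℓ , leaf

      twig-nbr : R ≡ suc k → Σ (Fin n) λ b → Adj G v b × IsTwigBase G H b
      twig-nbr R≡1+k with countIn-witness R≡1+k
      ... | b , b∈O , redb , _ with red-pendant-twig v∈H others-pendant b∈O redb
      ...   | twig , v~b = b , v~b , twig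

      counts : col c v u ≡ κ → col c v w ≡ κ′ →
        countIn H (blueEdge v) ≡ blueℕ κ + (blueℕ κ′ + B) ×
        countIn H (redEdge v) ≡ redℕ κ + (redℕ κ′ + R)
      counts col-u col-w with remove-edge u∈H v~u col-u | remove-edge w∈H-u v~w col-w
      ... | blues-u , reds-u | blues-w , reds-w =
        trans blues-u (cong (blueℕ _ +_) blues-w) , trans reds-u (cong (redℕ _ +_) reds-w)

      balance : col c v u ≡ κ → col c v w ≡ κ′ →
        blueℕ κ + (blueℕ κ′ + B) ≡ suc (redℕ κ + (redℕ κ′ + R))
      balance col-u col-w =
        trans (sym (proj₁ (counts col-u col-w)))
              (trans (diff1 v v∈H) (cong suc (proj₂ (counts col-u col-w))))

      degree : col c v u ≡ κ → col c v w ≡ κ′ →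
        deg G H v ≡ (blueℕ κ + (blueℕ κ′ + B)) + (redℕ κ + (redℕ κ′ + R))
      degree col-u col-w = deg-from-counts (proj₁ (counts col-u col-w)) (proj₂ (counts col-u col-w))

      leaf-type : col c v u ≡ blue → col c v w ≡ red → LeafType G H v
      leaf-type col-u col-w = v∈H , deg≡3 , leaf-nbr B≡1
        where
        B≡1+R : B ≡ 1 + R
        B≡1+R = suc-injective (balance col-u col-w)
        R≡0 : R ≡ 0
        R≡0 = unmixed-excess 1 unmixed B≡1+R
        B≡1 : B ≡ 1
        B≡1 = trans B≡1+R (cong suc R≡0)
        deg≡3 : deg G H v ≡ 3
        deg≡3 = trans (degree col-u col-w) (cong₂ (λ b r → suc b + suc r) B≡1 R≡0)

      twig-type : col c v u ≡ blue → col c v w ≡ blue → TwigType G H v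
      twig-type col-u col-w = v∈H , deg≡3 , twig-nbr R≡1
        where
        R≡1+B : R ≡ 1 + B
        R≡1+B = sym (suc-injective (balance col-u col-w))
        B≡0 : B ≡ 0
        B≡0 = unmixed-excess 1 (swap unmixed) R≡1+B
        R≡1 : R ≡ 1
        R≡1 = trans R≡1+B (cong suc B≡0)
        deg≡3 : deg G H v ≡ 3
        deg≡3 = trans (degree col-u col-w) (cong₂ (λ b r → suc (suc b) + r) B≡0 R≡1)

      triple-type : col c v u ≡ red → col c v w ≡ red → TripleType G H v
      triple-type col-u col-w = v∈H , deg≡5 , three-leaves (countIn-witness₃ B≡3)
        where
        B≡3+R : B ≡ 3 + R
        B≡3+R = balance col-u col-w
        R≡0 : R ≡ 0
        R≡0 = unmixed-excess 3 unmixed B≡3+R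
        B≡3 : B ≡ 3
        B≡3 = trans B≡3+R (cong (3 +_) R≡0)
        deg≡5 : deg G H v ≡ 5
        deg≡5 = trans (degree col-u col-w) (cong₂ (λ b r → b + suc (suc r)) B≡3 R≡0)
        three-leaves : (Σ (Fin n) λ a → Σ (Fin n) λ b → Σ (Fin n) λ c → a ≢ b × a ≢ c × b ≢ c ×
          a ∈ O × b ∈ O × c ∈ O × blueEdge v a ≡ true × blueEdge v b ≡ true × blueEdge v c ≡ true) →
          Σ (Fin n) λ w₁ → Σ (Fin n) λ w₂ → Σ (Fin n) λ w₃ → w₁ ≢ w₂ × w₁ ≢ w₃ × w₂ ≢ w₃ ×
          Adj G v w₁ × Adj G v w₂ × Adj G v w₃ × IsLeaf G H w₁ × IsLeaf G H w₂ × IsLeaf G H w₃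
        three-leaves (a , b , c , a≢b , a≢c , b≢c , a∈O , b∈O , c∈O , blue-a , blue-b , blue-c)
          with blue-pendant-leaf v∈H others-pendant a∈O blue-a
             | blue-pendant-leaf v∈H others-pendant b∈O blue-b
             | blue-pendant-leaf v∈H others-pendant c∈O blue-c
        ... | leaf-a , v~a | leaf-b , v~b | leaf-c , v~c =
          a , b , c , a≢b , a≢c , b≢c , v~a , v~b , v~c , leaf-a , leaf-b , leaf-c

    degree-two-type : ∀ {K} → Leafless G K → Retains G K H → PendantsOutside H K →
      ∀ {v} → v ∈ K → deg G K v ≡ 2 → LeafType G H v ⊎ TwigType G H v ⊎ TripleType G H v
    degree-two-type {K} leafless retains outside {v} v∈K deg≡2
      with countIn-witness₂ (trans (sym (deg≡countIn G K v)) deg≡2)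
    ... | u , w , u≢w , u∈K , w∈K , v~u , v~w = by-colours (col c v u) (col c v w) refl refl
      where
      module uw = DegreeTwoVertex leafless retains outside v∈K deg≡2 u∈K w∈K u≢w v~u v~w
      module wu = DegreeTwoVertex leafless retains outside v∈K deg≡2 w∈K u∈K (≢-sym u≢w) v~w v~u

      by-colours : ∀ κ κ′ → col c v u ≡ κ → col c v w ≡ κ′ →
        LeafType G H v ⊎ TwigType G H v ⊎ TripleType G H v
      by-colours blue red  col-u col-w = inj₁ (uw.leaf-type col-u col-w)
      by-colours red  blue col-u col-w = inj₁ (wu.leaf-type col-w col-u)
      by-colours blue blue col-u col-w = inj₂ (inj₁ (uw.twig-type col-u col-w))
      by-colours red  red  col-u col-w = inj₂ (inj₂ (uw.triple-type col-u col-w))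

mainTheorem14 : ∀ {n} (G : Graph n) (H K : Subset n) (c : Colouring G) →
    HasCycle G → IsReducedForm G H → IsSkeleton G K → IsDiff1 G c →
    ∀ v → v ∈ K → deg G K v ≡ 2 →
      (LeafType G H v ⊎ TwigType G H v ⊎ TripleType G H v) ×
      (∀ u w → u ∈ K → w ∈ K → u ≢ w → Adj G v u → Adj G v w →
        (col c v u ≡ blue → col c v w ≡ red → LeafType G H v) ×
        (col c v u ≡ blue → col c v w ≡ blue → TwigType G H v) ×
        (col c v u ≡ red → col c v w ≡ red → TripleType G H v))
mainTheorem14 G H K c _ (reduction , reduced) (deletion , leafless) diff1 v v∈K deg≡2
  with reduction-invariants G c leafless reduction (Diff1On-⊤ G c diff1) (λ _ _ _ → ∈⊤)
... | diff1-H , retains =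
  degree-two-type G c diff1-H reduced leafless retains outside v∈K deg≡2 ,
  λ u w u∈K w∈K u≢w v~u v~w →
    let open DegreeTwoVertex G c diff1-H reduced leafless retains outside v∈K deg≡2 u∈K w∈K u≢w v~u v~w
    in leaf-type , twig-type , triple-type
  where
  outside : PendantsOutside G c H K
  outside = pendants-outside G c diff1-H reduced deletion (pendants-outside-⊤ G c)
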